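{- Let $G$ be a graph, let $p=\chi(G)+k$ with $k\ge 0$ an integer, and let $\sigma$ be a proper colouring of $G$ using exactly $p$ colours. Then there exists $X\subseteq V(G)$ with $|X|\le k+1$ and $|\sigma(N[X])|=p$. Moreover, for every colour class $U$ of $\sigma$, there exists such a set $X$ with $X\cap U\neq\emptyset$.
   Context: $N[X]$ denotes the closed neighbourhood of $X$, i.e. $X$ together with all vertices adjacent to some vertex of $X$. -}

module Defs where

open import Data.Nat using (ℕ; _≤_)
open import Data.Bool using (Bool; true; false; _∧_; _∨_)
open import Data.Fin using (Fin; _≟_)
open import Data.Fin.Subset using (Subset; _∈_)
open import Data.Vec using (lookup; tabulate)
open import Data.List using (allFin)
open import Data.Bool.ListAction using (any)
open import Data.Product using (Σ; _×_)
open import Function.Definitions using (Surjective)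
open import Relation.Binary.PropositionalEquality using (_≡_; _≢_)
open import Relation.Nullary.Decidable using (⌊_⌋)

record Graph (n : ℕ) : Set where
  field
    adj    : Fin n → Fin n → Bool
    sym    : ∀ u v → adj u v ≡ adj v u
    irrefl : ∀ v → adj v v ≡ false
open Graph public

existsFin : (n : ℕ) → (Fin n → Bool) → Bool
existsFin n f = any f (allFin n)

N[_] : {n : ℕ} → Graph n → Subset n → Subset n
N[_] {n} G X = tabulate λ v → lookup X v ∨ existsFin n (λ x → lookup X x ∧ adj G x v)

image : {n p : ℕ} → (Fin n → Fin p) → Subset n → Subset p
image {n} σ Y = tabulate λ c → existsFin n (λ v → lookup Y v ∧ ⌊ σ v ≟ c ⌋)

Proper : {n m : ℕ} → Graph n → (Fin n → Fin m) → Set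
Proper G σ = ∀ u v → adj G u v ≡ true → σ u ≢ σ v

IsChromaticNumber : {n : ℕ} → Graph n → ℕ → Set
IsChromaticNumber {n} G χ =
  Σ (Fin n → Fin χ) (Proper G) ×
  (∀ (m : ℕ) (τ : Fin n → Fin m) → Proper G τ → χ ≤ m)

UsesAllColours : {n p : ℕ} → (Fin n → Fin p) → Set
UsesAllColours σ = Surjective _≡_ _≡_ σ

module Submission where

-- Fix a colour class and a set C of colours with χ(G[σ⁻¹(C)]) ≥ q. Pick x in the class
-- seeing as many colours of C as possible, and let B = C ∩ σ(N[x]), C′ = C − B. A proper
-- colouring of G[σ⁻¹(C′)] extends to G[σ⁻¹(C)] using the |B| − 1 extra colours B − σ(x):
-- vertices with these colours keep them, and each vertex of the class of x moves to a
-- colour of B − σ(x) it does not see; a vertex of that class seeing all of B sees, by the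
-- maximality of x, no colour of C′, so it may reuse any colour of σ⁻¹(C′). Hence
-- χ(G[σ⁻¹(C′)]) ≥ q − (|B| − 1), and induction on C gives X′ with σ(N[X′]) ⊇ C′ and
-- |X′| + q − (|B| − 1) ≤ |C′| + 1, so X = X′ ∪ {x} has σ(N[X]) ⊇ C and |X| + q ≤ |C| + 1.
-- For C the set of all χ + k colours this reads |X| ≤ k + 1.

open import Defs hiding (sym)
open import Data.Nat using (ℕ; zero; suc; _+_; _∸_; _≤_; _<_; z≤n; s≤s)
open import Data.Nat.Properties
  using (≤-trans; ≤-reflexive; <⇒≱; n≤1+n; m≤n+m; +-suc; +-comm; +-assoc; +-mono-≤; +-monoˡ-≤;
         +-monoʳ-≤; +-cancelʳ-≤; m≤n+m∸n; m≤n+o⇒m∸n≤o; module ≤-Reasoning)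
open import Data.Bool using (Bool; true; false; _∨_; _∧_)
open import Data.Bool.Properties using (T-≡; ∨-zeroʳ)
open import Data.Fin using (Fin; zero; suc; _≟_; _↑ˡ_; _↑ʳ_)
open import Data.Fin.Properties using (any?; ↑ˡ-injective; ↑ʳ-injective; suc-injective)
open import Data.Fin.Subset
  using (Subset; inside; outside; _∈_; _∉_; _⊆_; _⊂_; ∣_∣; _∩_; _∪_; ∁; _-_; ⁅_⁆; ⊤; ⊥)
open import Data.Fin.Subset.Properties
open import Data.Fin.Subset.Induction using (Acc; acc; ⊂-wellFounded)
open import Data.Vec using (_∷_; []; here; there; lookup; tabulate)
open import Data.Vec.Properties using (lookup∘tabulate; []=⇒lookup; lookup⇒[]=)
open import Data.List using (List; allFin; filter)
open import Data.List.Relation.Unary.Any using (satisfied)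
open import Data.List.Relation.Unary.Any.Properties using (any⁺; any⁻)
open import Data.List.Relation.Unary.All as All using ()
open import Data.List.Relation.Unary.All.Properties using (all-filter)
open import Data.List.Membership.Propositional using (lose)
open import Data.List.Membership.Propositional.Properties using (∈-allFin; ∈-filter⁺)
open import Data.List.Extrema.Nat using (argmax; argmax-all; f[xs]≤f[argmax])
open import Data.Nat.Solver using (module +-*-Solver)
open import Data.Product using (Σ; ∃; _×_; _,_; proj₁; proj₂)
open import Data.Sum using (_⊎_; inj₁; inj₂)
open import Data.Empty using (⊥-elim) renaming (⊥ to Empty)
open import Function.Bundles using (Equivalence)
open import Relation.Nullary using (¬_; Dec; yes; no; ¬?)
open import Relation.Nullary.Decidable using (_×-dec_; fromWitness)
open import Relation.Unary using (Decidable)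
open import Relation.Binary.PropositionalEquality
  using (_≡_; _≢_; refl; sym; trans; cong; cong₂; subst)

open +-*-Solver using (solve; _:+_; _:=_; con)

private
  variable
    m n p : ℕ

∈-tabulate⁺ : {f : Fin n → Bool} {x : Fin n} → f x ≡ true → x ∈ tabulate f
∈-tabulate⁺ {f = f} {x} fx = lookup⇒[]= x _ (trans (lookup∘tabulate f x) fx)

∈-tabulate⁻ : {f : Fin n → Bool} {x : Fin n} → x ∈ tabulate f → f x ≡ true
∈-tabulate⁻ {f = f} {x} x∈ = trans (sym (lookup∘tabulate f x)) ([]=⇒lookup x∈)

existsFin⁺ : {f : Fin n → Bool} (x : Fin n) → f x ≡ true → existsFin n f ≡ true
existsFin⁺ {n} {f} x fx =
  Equivalence.to T-≡ (any⁺ f (lose (∈-allFin x) (Equivalence.from T-≡ fx)))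

existsFin⁻ : {f : Fin n → Bool} → existsFin n f ≡ true → ∃ λ x → f x ≡ true
existsFin⁻ {n} {f} e with satisfied (any⁻ f (allFin n) (Equivalence.from T-≡ e))
... | x , fx = x , Equivalence.to T-≡ fx

module _ (G : Graph n) where

  ⊆-N[] : {X : Subset n} → X ⊆ N[ G ] X
  ⊆-N[] {X} {x} x∈X =
    ∈-tabulate⁺ (cong (_∨ existsFin n (λ y → lookup X y ∧ adj G y x)) ([]=⇒lookup x∈X))

  ∈-N[]⁺ : {X : Subset n} {x v : Fin n} → x ∈ X → adj G x v ≡ true → v ∈ N[ G ] X
  ∈-N[]⁺ {X} {x} {v} x∈X xv = ∈-tabulate⁺ (trans (cong (lookup X v ∨_) reaches) (∨-zeroʳ _))
    where
    reaches : existsFin n (λ y → lookup X y ∧ adj G y v) ≡ true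
    reaches = existsFin⁺ x (cong₂ _∧_ ([]=⇒lookup x∈X) xv)

  ∈-N[]⁻ : {X : Subset n} {v : Fin n} → v ∈ N[ G ] X →
           v ∈ X ⊎ ∃ λ x → x ∈ X × adj G x v ≡ true
  ∈-N[]⁻ {X} {v} v∈N with lookup X v in v∈X | ∈-tabulate⁻ v∈N
  ... | true  | _ = inj₁ (lookup⇒[]= v X v∈X)
  ... | false | reaches with existsFin⁻ reaches
  ...   | x , xv with lookup X x in x∈X
  ...     | true = inj₂ (x , lookup⇒[]= x X x∈X , xv)

  N[]-mono : {X Y : Subset n} → X ⊆ Y → N[ G ] X ⊆ N[ G ] Y
  N[]-mono X⊆Y v∈N with ∈-N[]⁻ v∈N
  ... | inj₁ v∈X            = ⊆-N[] (X⊆Y v∈X)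
  ... | inj₂ (x , x∈X , xv) = ∈-N[]⁺ (X⊆Y x∈X) xv

module _ (σ : Fin n → Fin p) where

  ∈-image⁺ : {Y : Subset n} {v : Fin n} → v ∈ Y → σ v ∈ image σ Y
  ∈-image⁺ {Y} {v} v∈Y =
    ∈-tabulate⁺ (existsFin⁺ v (cong₂ _∧_ ([]=⇒lookup v∈Y) (Equivalence.to T-≡ (fromWitness refl))))

  ∈-image⁻ : {Y : Subset n} {c : Fin p} → c ∈ image σ Y → ∃ λ v → v ∈ Y × σ v ≡ c
  ∈-image⁻ {Y} {c} c∈ with existsFin⁻ (∈-tabulate⁻ c∈)
  ... | v , hit with lookup Y v in v∈Y | σ v ≟ c
  ...   | true | yes σv≡c = v , lookup⇒[]= v Y v∈Y , σv≡c

  image-mono : {Y Z : Subset n} → Y ⊆ Z → image σ Y ⊆ image σ Z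
  image-mono Y⊆Z c∈ with ∈-image⁻ c∈
  ... | v , v∈Y , refl = ∈-image⁺ (Y⊆Z v∈Y)

∣p∩q∣+∣p∩∁q∣≡∣p∣ : (p q : Subset n) → ∣ p ∩ q ∣ + ∣ p ∩ ∁ q ∣ ≡ ∣ p ∣
∣p∩q∣+∣p∩∁q∣≡∣p∣ []            []            = refl
∣p∩q∣+∣p∩∁q∣≡∣p∣ (inside  ∷ p) (inside  ∷ q) = cong suc (∣p∩q∣+∣p∩∁q∣≡∣p∣ p q)
∣p∩q∣+∣p∩∁q∣≡∣p∣ (inside  ∷ p) (outside ∷ q) = trans (+-suc _ _) (cong suc (∣p∩q∣+∣p∩∁q∣≡∣p∣ p q))
∣p∩q∣+∣p∩∁q∣≡∣p∣ (outside ∷ p) (_       ∷ q) = ∣p∩q∣+∣p∩∁q∣≡∣p∣ p q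

∣p∪q∣≤∣p∣+∣q∣ : (p q : Subset n) → ∣ p ∪ q ∣ ≤ ∣ p ∣ + ∣ q ∣
∣p∪q∣≤∣p∣+∣q∣ []            []            = z≤n
∣p∪q∣≤∣p∣+∣q∣ (inside  ∷ p) (inside  ∷ q) =
  s≤s (≤-trans (∣p∪q∣≤∣p∣+∣q∣ p q) (+-monoʳ-≤ ∣ p ∣ (n≤1+n ∣ q ∣)))
∣p∪q∣≤∣p∣+∣q∣ (inside  ∷ p) (outside ∷ q) = s≤s (∣p∪q∣≤∣p∣+∣q∣ p q)
∣p∪q∣≤∣p∣+∣q∣ (outside ∷ p) (inside  ∷ q) =
  ≤-trans (s≤s (∣p∪q∣≤∣p∣+∣q∣ p q)) (≤-reflexive (sym (+-suc _ _)))
∣p∪q∣≤∣p∣+∣q∣ (outside ∷ p) (outside ∷ q) = ∣p∪q∣≤∣p∣+∣q∣ p q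

p⊆q∧∣q∣≤∣p∣⇒q⊆p : {p q : Subset n} → p ⊆ q → ∣ q ∣ ≤ ∣ p ∣ → q ⊆ p
p⊆q∧∣q∣≤∣p∣⇒q⊆p {p = p} p⊆q ∣q∣≤∣p∣ {x} x∈q with x ∈? p
... | yes x∈p = x∈p
... | no  x∉p = ⊥-elim (<⇒≱ (p⊂q⇒∣p∣<∣q∣ (p⊆q , x , x∈q , x∉p)) ∣q∣≤∣p∣)

rank : (p : Subset n) {x : Fin n} → x ∈ p → Fin ∣ p ∣
rank (inside  ∷ p) here      = zero
rank (inside  ∷ p) (there h) = suc (rank p h)
rank (outside ∷ p) (there h) = rank p h

rank-injective : (p : Subset n) {x y : Fin n} (x∈p : x ∈ p) (y∈p : y ∈ p) →
                 rank p x∈p ≡ rank p y∈p → x ≡ y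
rank-injective (inside  ∷ p) here       here       _ = refl
rank-injective (inside  ∷ p) (there x∈) (there y∈) e =
  cong suc (rank-injective p x∈ y∈ (suc-injective e))
rank-injective (outside ∷ p) (there x∈) (there y∈) e = cong suc (rank-injective p x∈ y∈ e)

↑ˡ≢↑ʳ : (i : Fin m) (j : Fin n) → i ↑ˡ n ≢ m ↑ʳ j
↑ˡ≢↑ʳ zero    j ()
↑ˡ≢↑ʳ (suc i) j e = ↑ˡ≢↑ʳ i j (suc-injective e)

argmaxOn : (f : Fin n → ℕ) {P : Fin n → Set} → Decidable P → {x₀ : Fin n} → P x₀ →
           ∃ λ x → P x × (∀ y → P y → f y ≤ f x)
argmaxOn {n} f {P} P? {x₀} Px₀ =
  argmax f x₀ xs ,
  argmax-all f Px₀ (all-filter P? (allFin n)) ,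
  λ y Py → All.lookup (f[xs]≤f[argmax] {f = f} x₀ xs) (∈-filter⁺ P? (∈-allFin y) Py)
  where
  xs : List (Fin n)
  xs = filter P? (allFin n)

module Colouring (G : Graph n) (σ : Fin n → Fin p) (σ-proper : Proper G σ) where

  ProperOn : Subset p → (Fin n → Fin m) → Set
  ProperOn C τ = ∀ u v → σ u ∈ C → σ v ∈ C → adj G u v ≡ true → τ u ≢ τ v

  ChromaticAtLeast : ℕ → Subset p → Set
  ChromaticAtLeast q C = ∀ m (τ : Fin n → Fin m) → ProperOn C τ → q ≤ m

  Used : Subset p → Set
  Used C = ∀ {c} → c ∈ C → ∃ λ v → σ v ≡ c

  seen : Fin n → Subset p
  seen x = image σ (N[ G ] ⁅ x ⁆)

  σ∈seen : (x : Fin n) → σ x ∈ seen x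
  σ∈seen x = ∈-image⁺ σ (⊆-N[] G (x∈⁅x⁆ x))

  adj⇒σ∈seen : {x v : Fin n} → adj G x v ≡ true → σ v ∈ seen x
  adj⇒σ∈seen xv = ∈-image⁺ σ (∈-N[]⁺ G (x∈⁅x⁆ _) xv)

  adj-sym : {u v : Fin n} → adj G u v ≡ true → adj G v u ≡ true
  adj-sym {u} {v} uv = trans (Graph.sym G v u) uv

  module Recolouring {C : Subset p} (x : Fin n)
                     (x-max : ∀ u → σ u ≡ σ x → ∣ C ∩ seen u ∣ ≤ ∣ C ∩ seen x ∣) where

    B C′ A : Subset p
    B  = C ∩ seen x
    C′ = C ∩ ∁ (seen x)
    A  = B - σ x

    same-colour : {u v : Fin n} → σ u ≡ σ x → σ v ≡ σ x → adj G u v ≡ true → Empty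
    same-colour {u} {v} σu σv uv = σ-proper u v uv (trans σu (sym σv))

    -- Maximality of x turns B ⊆ C ∩ seen u into an equality.
    isolated : {u v : Fin n} → σ u ≡ σ x → B ⊆ seen u → adj G u v ≡ true → σ v ∉ C′
    isolated {u} {v} σu B⊆seen uv σv∈C′ =
      x∈∁p⇒x∉p (proj₂ (x∈p∩q⁻ C _ σv∈C′)) (proj₂ (x∈p∩q⁻ C _ σv∈B))
      where
      B⊆C∩seen : B ⊆ C ∩ seen u
      B⊆C∩seen b∈B = x∈p∩q⁺ (proj₁ (x∈p∩q⁻ C _ b∈B) , B⊆seen b∈B)
      σv∈B : σ v ∈ B
      σv∈B = p⊆q∧∣q∣≤∣p∣⇒q⊆p B⊆C∩seen (x-max u σu)
               (x∈p∩q⁺ (proj₁ (x∈p∩q⁻ C _ σv∈C′) , adj⇒σ∈seen uv))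

    ∈C∧∉C′⇒∈B : {a : Fin p} → a ∈ C → a ∉ C′ → a ∈ B
    ∈C∧∉C′⇒∈B {a} a∈C a∉C′ with a ∈? seen x
    ... | yes a∈seen = x∈p∩q⁺ (a∈C , a∈seen)
    ... | no  a∉seen = ⊥-elim (a∉C′ (x∈p∩q⁺ (a∈C , x∉p⇒x∈∁p a∉seen)))

    in-class-of-x : {v : Fin n} → σ v ∈ C → σ v ∉ C′ → σ v ∉ A → σ v ≡ σ x
    in-class-of-x {v} σv∈C σv∉C′ σv∉A with σ v ≟ σ x
    ... | yes σv≡σx = σv≡σx
    ... | no  σv≢σx = ⊥-elim (σv∉A (x∈p∧x≢y⇒x∈p-y (∈C∧∉C′⇒∈B σv∈C σv∉C′) σv≢σx))

    MissesA : Fin n → Set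
    MissesA v = ∃ λ a → a ∈ A × a ∉ seen v

    missesA? : (v : Fin n) → Dec (MissesA v)
    missesA? v = any? (λ a → (a ∈? A) ×-dec ¬? (a ∈? seen v))

    B⊆seen : {v : Fin n} → σ v ≡ σ x → ¬ MissesA v → B ⊆ seen v
    B⊆seen {v} σv≡σx sees-A {b} b∈B with b ≟ σ x | b ∈? seen v
    ... | _          | yes b∈seen = b∈seen
    ... | yes refl   | no  _      = subst (_∈ seen v) σv≡σx (σ∈seen v)
    ... | no  b≢σx   | no  b∉seen = ⊥-elim (sees-A (b , x∈p∧x≢y⇒x∈p-y b∈B b≢σx , b∉seen))

    module Extension {m : ℕ} (τ′ : Fin n → Fin m) (j : Fin m) where

      data Role (v : Fin n) : Fin (m + ∣ A ∣) → Set where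
        outer  : σ v ∈ C′ → Role v (τ′ v ↑ˡ ∣ A ∣)
        kept   : (σv∈A : σ v ∈ A) → Role v (m ↑ʳ rank A σv∈A)
        moved  : σ v ≡ σ x → {a : Fin p} (a∈A : a ∈ A) → a ∉ seen v → Role v (m ↑ʳ rank A a∈A)
        parked : σ v ≡ σ x → B ⊆ seen v → Role v (j ↑ˡ ∣ A ∣)

      recolour : Fin n → Fin (m + ∣ A ∣)
      recolour v with σ v ∈? C′ | σ v ∈? A | missesA? v
      ... | yes _ | _         | _                 = τ′ v ↑ˡ ∣ A ∣
      ... | no _  | yes σv∈A  | _                 = m ↑ʳ rank A σv∈A
      ... | no _  | no _      | yes (_ , a∈A , _) = m ↑ʳ rank A a∈A
      ... | no _  | no _      | no _              = j ↑ˡ ∣ A ∣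

      role : (v : Fin n) → σ v ∈ C → Role v (recolour v)
      role v σv∈C with σ v ∈? C′ | σ v ∈? A | missesA? v
      ... | yes σv∈C′ | _        | _                    = outer σv∈C′
      ... | no _      | yes σv∈A | _                    = kept σv∈A
      ... | no σv∉C′  | no σv∉A  | yes (_ , a∈A , a∉) = moved (in-class-of-x σv∈C σv∉C′ σv∉A) a∈A a∉
      ... | no σv∉C′  | no σv∉A  | no sees-A            =
        let σv≡σx = in-class-of-x σv∈C σv∉C′ σv∉A in parked σv≡σx (B⊆seen σv≡σx sees-A)

      module _ (τ′-proper : ProperOn C′ τ′) where

        clash : {u v : Fin n} {s t : Fin (m + ∣ A ∣)} →
                Role u s → Role v t → adj G u v ≡ true → s ≢ t
        clash (outer σu∈C′)   (outer σv∈C′)   uv e = τ′-proper _ _ σu∈C′ σv∈C′ uv (↑ˡ-injective _ _ _ e)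
        clash (outer _)       (kept _)        _  e = ↑ˡ≢↑ʳ _ _ e
        clash (outer _)       (moved _ _ _)   _  e = ↑ˡ≢↑ʳ _ _ e
        clash (outer σu∈C′)   (parked σv B⊆)  uv _ = isolated σv B⊆ (adj-sym uv) σu∈C′
        clash (kept _)        (outer _)       _  e = ↑ˡ≢↑ʳ _ _ (sym e)
        clash (kept σu∈A)     (kept σv∈A)     uv e =
          σ-proper _ _ uv (rank-injective A σu∈A σv∈A (↑ʳ-injective _ _ _ e))
        clash {v = v} (kept σu∈A) (moved _ a∈A a∉) uv e =
          a∉ (subst (_∈ seen v) (rank-injective A σu∈A a∈A (↑ʳ-injective _ _ _ e)) (adj⇒σ∈seen (adj-sym uv)))
        clash (kept _)        (parked _ _)    _  e = ↑ˡ≢↑ʳ _ _ (sym e)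
        clash (moved _ _ _)   (outer _)       _  e = ↑ˡ≢↑ʳ _ _ (sym e)
        clash {u = u} (moved _ a∈A a∉) (kept σv∈A) uv e =
          a∉ (subst (_∈ seen u) (rank-injective A σv∈A a∈A (↑ʳ-injective _ _ _ (sym e))) (adj⇒σ∈seen uv))
        clash (moved σu _ _)  (moved σv _ _)  uv _ = same-colour σu σv uv
        clash (moved _ _ _)   (parked _ _)    _  e = ↑ˡ≢↑ʳ _ _ (sym e)
        clash (parked σu B⊆)  (outer σv∈C′)   uv _ = isolated σu B⊆ uv σv∈C′
        clash (parked _ _)    (kept _)        _  e = ↑ˡ≢↑ʳ _ _ e
        clash (parked _ _)    (moved _ _ _)   _  e = ↑ˡ≢↑ʳ _ _ e
        clash (parked σu _)   (parked σv _)   uv _ = same-colour σu σv uv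

        recolour-proper : ProperOn C recolour
        recolour-proper u v σu∈C σv∈C = clash (role u σu∈C) (role v σv∈C)

    -- τ′ x only serves as an arbitrary spare colour.
    lowerBound-C′ : {q : ℕ} → ChromaticAtLeast q C → ChromaticAtLeast (q ∸ ∣ A ∣) C′
    lowerBound-C′ {q} χ≥q m τ′ τ′-proper = m≤n+o⇒m∸n≤o q ∣ A ∣
      (subst (q ≤_) (+-comm m ∣ A ∣) (χ≥q (m + ∣ A ∣) recolour (recolour-proper τ′-proper)))
      where open Extension τ′ (τ′ x)

  SmallDominator : Subset p → ℕ → Subset n → Set
  SmallDominator C q X = (∣ X ∣ + q ≤ ∣ C ∣ + 1) × (C ⊆ image σ (N[ G ] X))

  Meets : Subset n → Fin p → Set
  Meets X c = Σ (Fin n) λ x → (x ∈ X) × (σ x ≡ c)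

  ⊥-smallDominator : {C : Subset p} {q : ℕ} → ChromaticAtLeast q C → (∀ c → c ∉ C) →
                     SmallDominator C q ⊥
  ⊥-smallDominator {C} {q} χ≥q empty = size , λ {c} c∈C → ⊥-elim (empty c c∈C)
    where
    q≤1 : q ≤ 1
    q≤1 = χ≥q 1 (λ _ → zero) (λ u _ σu∈C _ _ _ → empty (σ u) σu∈C)
    size : ∣ ⊥ {n} ∣ + q ≤ ∣ C ∣ + 1
    size rewrite ∣⊥∣≡0 n = ≤-trans q≤1 (m≤n+m 1 ∣ C ∣)

  mutual
    smallDominator : {C : Subset p} → Acc _⊂_ C → {q : ℕ} → ChromaticAtLeast q C → Used C →
                     ∃ (SmallDominator C q)
    smallDominator {C} wf χ≥q used with any? (_∈? C)
    ... | no  empty     = ⊥ , ⊥-smallDominator χ≥q (λ c c∈C → empty (c , c∈C))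
    ... | yes (c , c∈C) with smallDominatorMeeting wf χ≥q used c∈C
    ...   | X , small , _ = X , small

    smallDominatorMeeting : {C : Subset p} → Acc _⊂_ C → {q : ℕ} → ChromaticAtLeast q C → Used C →
                            {c : Fin p} → c ∈ C → Σ (Subset n) λ X → SmallDominator C q X × Meets X c
    smallDominatorMeeting {C} (acc smaller) {q} χ≥q used c∈C with used c∈C
    ... | v , refl with argmaxOn (λ u → ∣ C ∩ seen u ∣) (λ u → σ u ≟ σ v) refl
    ... | x , σx≡σv , x-max = X , (size , covers) , x , q⊆p∪q X′ ⁅ x ⁆ (x∈⁅x⁆ x) , σx≡σv
      where
      open Recolouring {C} x (λ u σu≡σx → x-max u (trans σu≡σx σx≡σv))

      σx∈C : σ x ∈ C
      σx∈C = subst (_∈ C) (sym σx≡σv) c∈C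

      C′⊂C : C′ ⊂ C
      C′⊂C = p∩q⊆p C _ , σ x , σx∈C , λ σx∈C′ → x∈∁p⇒x∉p (proj₂ (x∈p∩q⁻ C _ σx∈C′)) (σ∈seen x)

      rest : ∃ (SmallDominator C′ (q ∸ ∣ A ∣))
      rest = smallDominator (smaller C′⊂C) (lowerBound-C′ χ≥q)
                            (λ a∈C′ → used (proj₁ (x∈p∩q⁻ C _ a∈C′)))

      X′ X : Subset n
      X′ = proj₁ rest
      X  = X′ ∪ ⁅ x ⁆

      covers : C ⊆ image σ (N[ G ] X)
      covers {a} a∈C with a ∈? seen x
      ... | yes a∈seen = image-mono σ (N[]-mono G (q⊆p∪q X′ ⁅ x ⁆)) a∈seen
      ... | no  a∉seen = image-mono σ (N[]-mono G (p⊆p∪q {p = X′} ⁅ x ⁆))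
                           (proj₂ (proj₂ rest) (x∈p∩q⁺ (a∈C , x∉p⇒x∈∁p a∉seen)))

      ∣X∣≤∣X′∣+1 : ∣ X ∣ ≤ ∣ X′ ∣ + 1
      ∣X∣≤∣X′∣+1 = ≤-trans (∣p∪q∣≤∣p∣+∣q∣ X′ ⁅ x ⁆) (≤-reflexive (cong (∣ X′ ∣ +_) (∣⁅x⁆∣≡1 x)))

      ∣A∣<∣B∣ : ∣ A ∣ < ∣ B ∣
      ∣A∣<∣B∣ = x∈p⇒∣p-x∣<∣p∣ (x∈p∩q⁺ (σx∈C , σ∈seen x))

      size : ∣ X ∣ + q ≤ ∣ C ∣ + 1
      size = begin
        ∣ X ∣ + q                              ≤⟨ +-monoˡ-≤ q ∣X∣≤∣X′∣+1 ⟩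
        (∣ X′ ∣ + 1) + q                       ≤⟨ +-monoʳ-≤ (∣ X′ ∣ + 1) (m≤n+m∸n q ∣ A ∣) ⟩
        (∣ X′ ∣ + 1) + (∣ A ∣ + (q ∸ ∣ A ∣))  ≡⟨ shuffle ∣ X′ ∣ ∣ A ∣ (q ∸ ∣ A ∣) ⟩
        (∣ X′ ∣ + (q ∸ ∣ A ∣)) + suc ∣ A ∣    ≤⟨ +-mono-≤ (proj₁ (proj₂ rest)) ∣A∣<∣B∣ ⟩
        (∣ C′ ∣ + 1) + ∣ B ∣                   ≡⟨ shuffle′ ∣ C′ ∣ ∣ B ∣ ⟩
        (∣ B ∣ + ∣ C′ ∣) + 1                   ≡⟨ cong (_+ 1) (∣p∩q∣+∣p∩∁q∣≡∣p∣ C (seen x)) ⟩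
        ∣ C ∣ + 1                              ∎
        where
        open ≤-Reasoning
        shuffle : ∀ y a r → (y + 1) + (a + r) ≡ (y + r) + suc a
        shuffle = solve 3 (λ y a r → (y :+ con 1) :+ (a :+ r) := (y :+ r) :+ (con 1 :+ a)) refl
        shuffle′ : ∀ c b → (c + 1) + b ≡ (b + c) + 1
        shuffle′ = solve 2 (λ c b → (c :+ con 1) :+ b := (b :+ c) :+ con 1) refl

⊤⊆p⇒∣p∣≡n : {p : Subset n} → ⊤ ⊆ p → ∣ p ∣ ≡ n
⊤⊆p⇒∣p∣≡n {n} ⊤⊆p = trans (cong ∣_∣ (⊆-antisym ⊆⊤ ⊤⊆p)) (∣⊤∣≡n n)

lemma3p3 : (n : ℕ) (G : Graph n) (χ k : ℕ) → IsChromaticNumber G χ →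
    (σ : Fin n → Fin (χ + k)) → Proper G σ → UsesAllColours σ →
    (Σ (Subset n) λ X → (∣ X ∣ ≤ k + 1) × (∣ image σ (N[ G ] X) ∣ ≡ χ + k))
    × ((c : Fin (χ + k)) → Σ (Subset n) λ X →
        (∣ X ∣ ≤ k + 1) × (∣ image σ (N[ G ] X) ∣ ≡ χ + k)
        × Σ (Fin n) λ x → (x ∈ X) × (σ x ≡ c))
lemma3p3 n G χ k (_ , χ-minimal) σ σ-proper σ-onto =
  (let X , dom = smallDominator (⊂-wellFounded ⊤) χ≤χ[G] allUsed in X , bounds X dom) ,
  λ c → let X , dom , meets = smallDominatorMeeting (⊂-wellFounded ⊤) χ≤χ[G] allUsed (∈⊤ {x = c})
        in X , proj₁ (bounds X dom) , proj₂ (bounds X dom) , meets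
  where
  open Colouring G σ σ-proper

  χ≤χ[G] : ChromaticAtLeast χ ⊤
  χ≤χ[G] m τ τ-proper = χ-minimal m τ (λ u v → τ-proper u v ∈⊤ ∈⊤)

  allUsed : Used ⊤
  allUsed {c} _ = proj₁ (σ-onto c) , proj₂ (σ-onto c) refl

  bounds : (X : Subset n) → SmallDominator ⊤ χ X →
           (∣ X ∣ ≤ k + 1) × (∣ image σ (N[ G ] X) ∣ ≡ χ + k)
  bounds X (size , covers) =
    +-cancelʳ-≤ χ ∣ X ∣ (k + 1) (subst (∣ X ∣ + χ ≤_) ∣⊤∣+1≡k+1+χ size) , ⊤⊆p⇒∣p∣≡n covers
    where
    ∣⊤∣+1≡k+1+χ : ∣ ⊤ {χ + k} ∣ + 1 ≡ (k + 1) + χ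
    ∣⊤∣+1≡k+1+χ = trans (cong (_+ 1) (∣⊤∣≡n (χ + k))) (trans (+-assoc χ k 1) (+-comm χ (k + 1)))
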